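{- Let $s\ge 1$ be an integer and let $C_{2s+1}$ be the cycle on $2s+1$ vertices. Let $\mathcal{I}=(I_1,I_2,\ldots,I_s)$ be a family of $s$ (not necessarily distinct) independent sets of $C_{2s+1}$, each of size $s$. Then there is a rainbow independent set of size $s$ for $\mathcal{I}$ in $C_{2s+1}$, i.e. there exist pairwise distinct vertices $x_1\in I_1,\, x_2\in I_2,\ldots,\, x_s\in I_s$ such that $\{x_1,\ldots,x_s\}$ is an independent set of $C_{2s+1}$. Consequently, $f_{C_{2s+1}}(s,s)=s$.
   Context: A set of vertices of a graph is independent if it contains no edge; an $n$-set is a set of size $n$. For a family $\mathcal{F}=(F_1,\ldots,F_m)$ of (not necessarily distinct) sets, a (partial) rainbow set for $\mathcal{F}$ is a set $R=\{x_{i_1},\ldots,x_{i_k}\}$ with $1\le i_1<\cdots<i_k\le m$, $x_{i_j}\in F_{i_j}$ for all $j$, and the elements $x_{i_j}$ pairwise distinct; a rainbow independent set is a rainbow set that is independent. For a graph $G$ and integers $m\le n$, $f_G(n,m)$ denotes the minimal number $k$ such that every family of $k$ independent $n$-sets in $G$ has a (partial) rainbow independent $m$-set. -}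

module Defs where

open import Data.Nat using (ℕ; suc; _+_; _*_; _%_; _≤_; _<_; NonZero)
open import Data.Fin using (Fin; toℕ) renaming (_<_ to _<ᶠ_)
open import Data.Fin.Subset using (Subset; _∈_; ∣_∣)
open import Data.Product using (Σ; _×_)
open import Data.Sum using (_⊎_)
open import Relation.Binary.PropositionalEquality using (_≡_; _≢_)
open import Relation.Nullary using (¬_)

Graph : ℕ → Set₁
Graph n = Fin n → Fin n → Set

Cycle : (n : ℕ) → .{{_ : NonZero n}} → Graph n
Cycle n a b = (toℕ b ≡ (toℕ a + 1) % n) ⊎ (toℕ a ≡ (toℕ b + 1) % n)

C : (s : ℕ) → Graph (suc (2 * s))
C s = Cycle (suc (2 * s))

Independent : ∀ {n} → Graph n → Subset n → Set
Independent G I = ∀ a b → a ∈ I → b ∈ I → ¬ G a b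

IndependentOfSize : ∀ {n} → Graph n → ℕ → Subset n → Set
IndependentOfSize G m I = Independent G I × ∣ I ∣ ≡ m

RainbowIndep : ∀ {n k} → Graph n → (Fin k → Subset n) → ℕ → Set
RainbowIndep {n} {k} G F m =
  Σ (Fin m → Fin k) λ ι →
  Σ (Fin m → Fin n) λ x →
    (∀ j j′ → j <ᶠ j′ → ι j <ᶠ ι j′) ×
    (∀ j → x j ∈ F (ι j)) ×
    (∀ j j′ → j ≢ j′ → x j ≢ x j′) ×
    (∀ j j′ → ¬ G (x j) (x j′))

Good : ∀ {n} → Graph n → ℕ → ℕ → ℕ → Set
Good G n′ m k = (F : Fin k → Subset _) → (∀ i → IndependentOfSize G n′ (F i)) → RainbowIndep G F m

fIs : ∀ {n} → Graph n → ℕ → ℕ → ℕ → Set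
fIs G n′ m v = Good G n′ m v × (∀ k → k < v → ¬ Good G n′ m k)

module Submission where

-- Every independent s-set of C_{2s+1} is a progression u, u + 2, …, u + 2(s − 1) modulo 2s + 1.
-- Halving (multiplication by s + 1) turns the progression of I i into the arc of s residues starting
-- at a i = (s + 1) u i.  By a cycle-lemma argument there is a cut c such that, listing the offsets of
-- the a i from c in increasing order, the k-th offset lies in [k + 1, k + s]; such a cut is a point whose
-- class of N p − p modulo s + 1 (N counting the a i below p) occurs only once in a period, which
-- exists by pigeonhole because 2s + 1 < 2(s + 1).  Giving I i the vertex 2(c + s + k), where k is the
-- rank of i, puts it on the progression of I i, and these vertices form the independent progression
-- 2(c + s), 2(c + s) + 2, ….  Fewer than s copies of one independent s-set have no rainbow s-set.

open import Defs
open import Data.Nat.Base using (ℕ; zero; suc; _+_; _*_; _∸_; _≤_; _<_; z≤n; s≤s)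
open import Data.Nat.Properties
open import Data.Nat.DivMod using (_%_; _mod_; m%n<n; m%n%n≡m%n; [m+kn]%n≡m%n; %-distribˡ-+; %-distribˡ-*; m<n⇒m%n≡m)
open import Data.Nat.Tactic.RingSolver using (solve-∀)
open import Data.Fin.Base as Fin using (Fin; toℕ; fromℕ<; splitAt; join)
open import Data.Fin.Properties as Finₚ using (any?; all?; ¬∀⟶∃¬; pigeonhole; toℕ-fromℕ<; fromℕ<-cong; fromℕ<-toℕ; toℕ<n; toℕ-injective; join-splitAt)
open import Data.Fin.Subset using (Subset; _∈_; ∣_∣; inside; outside)
open import Data.Fin.Subset.Properties using (_∈?_)
open import Data.Product using (Σ; ∃; _×_; _,_; proj₁; proj₂)
open import Data.Sum using (_⊎_; inj₁; inj₂; [_,_]′)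
open import Data.Empty using (⊥; ⊥-elim)
open import Data.Vec.Base using (_∷_; []; tabulate)
open import Data.Vec.Properties using (lookup∘tabulate; []=⇒lookup)
open import Data.Bool.Base using (Bool; true; false)
open import Function.Base using (_∘_)
open import Relation.Nullary using (¬_; Dec; yes; no; ¬?; _×-dec_; _⊎-dec_)
open import Relation.Nullary.Decidable using (map′)
open import Relation.Binary.PropositionalEquality
open import Relation.Binary.Definitions using (tri<; tri≈; tri>)
open import Relation.Binary.Bundles using (Setoid)
import Relation.Binary.Reasoning.Setoid as SetoidReasoning
open import Level using (0ℓ)
open import Algebra.Properties.CommutativeMonoid.Sum +-0-commutativeMonoid using (sum; ∑-distrib-+)
open import Algebra.Properties.CommutativeSemigroup +-commutativeSemigroup using (xy∙z≈xz∙y)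

private variable
  m : ℕ
  P Q : Set

χ : Dec P → ℕ
χ (yes _) = 1
χ (no _)  = 0

χ≤1 : (d : Dec P) → χ d ≤ 1
χ≤1 (yes _) = s≤s z≤n
χ≤1 (no _)  = z≤n

χ-yes : (d : Dec P) → P → χ d ≡ 1
χ-yes (yes _) _ = refl
χ-yes (no ¬p) p = ⊥-elim (¬p p)

χ-no : (d : Dec P) → ¬ P → χ d ≡ 0
χ-no (yes p) ¬p = ⊥-elim (¬p p)
χ-no (no _)  _  = refl

χ≡1⇒ : (d : Dec P) → χ d ≡ 1 → P
χ≡1⇒ (yes p) _ = p

χ-mono : (d : Dec P) (e : Dec Q) → (P → Q) → χ d ≤ χ e
χ-mono (yes p) (yes _) _  = ≤-refl
χ-mono (yes p) (no ¬q) f  = ⊥-elim (¬q (f p))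
χ-mono (no _)  _       _  = z≤n

χ-cong : (d : Dec P) (e : Dec Q) → (P → Q) → (Q → P) → χ d ≡ χ e
χ-cong d e f g = ≤-antisym (χ-mono d e f) (χ-mono e d g)

χ-map′ : {f : P → Q} {g : Q → P} (d : Dec P) → χ (map′ f g d) ≡ χ d
χ-map′ (yes _) = refl
χ-map′ (no _)  = refl

sum-cong : {f g : Fin m → ℕ} → (∀ i → f i ≡ g i) → sum f ≡ sum g
sum-cong {zero}  eq = refl
sum-cong {suc m} eq = cong₂ _+_ (eq Fin.zero) (sum-cong (eq ∘ Fin.suc))

sum-mono-≤ : {f g : Fin m → ℕ} → (∀ i → f i ≤ g i) → sum f ≤ sum g
sum-mono-≤ {zero}  le = z≤n
sum-mono-≤ {suc m} le = +-mono-≤ (le Fin.zero) (sum-mono-≤ (le ∘ Fin.suc))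

sum-mono-< : {f g : Fin m → ℕ} → (∀ i → f i ≤ g i) → ∀ i → f i < g i → sum f < sum g
sum-mono-< {suc m} le Fin.zero    lt = +-mono-<-≤ lt (sum-mono-≤ (le ∘ Fin.suc))
sum-mono-< {suc m} le (Fin.suc i) lt = +-mono-≤-< (le Fin.zero) (sum-mono-< (le ∘ Fin.suc) i lt)

sum-zero : {f : Fin m → ℕ} → (∀ i → f i ≡ 0) → sum f ≡ 0
sum-zero {zero}  eq = refl
sum-zero {suc m} eq = cong₂ _+_ (eq Fin.zero) (sum-zero (eq ∘ Fin.suc))

sum-one : {f : Fin m → ℕ} → (∀ i → f i ≡ 1) → sum f ≡ m
sum-one {zero}  eq = refl
sum-one {suc m} eq = cong₂ _+_ (eq Fin.zero) (sum-one (eq ∘ Fin.suc))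

sum-≤-length : {f : Fin m → ℕ} → (∀ i → f i ≤ 1) → sum f ≤ m
sum-≤-length {zero}  le = z≤n
sum-≤-length {suc m} le = +-mono-≤ (le Fin.zero) (sum-≤-length (le ∘ Fin.suc))

sum-≥-length : {f : Fin m → ℕ} → (∀ i → 1 ≤ f i) → m ≤ sum f
sum-≥-length {zero}  ge = z≤n
sum-≥-length {suc m} ge = +-mono-≤ (ge Fin.zero) (sum-≥-length (ge ∘ Fin.suc))

sum-<-length : {f : Fin m → ℕ} → (∀ i → f i ≤ 1) → ∀ i → f i ≡ 0 → sum f < m
sum-<-length {suc m} {f} le Fin.zero    eq = subst (λ z → z + sum (f ∘ Fin.suc) < suc m) (sym eq) (s≤s (sum-≤-length (le ∘ Fin.suc)))
sum-<-length {suc m}     le (Fin.suc i) eq = +-mono-≤-< (le Fin.zero) (sum-<-length (le ∘ Fin.suc) i eq)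

∣∣≡sum-χ : (p : Subset m) → ∣ p ∣ ≡ sum (λ x → χ (x ∈? p))
∣∣≡sum-χ []           = refl
∣∣≡sum-χ (inside ∷ p)  = cong suc (trans (∣∣≡sum-χ p) (sum-cong (λ x → sym (χ-map′ (x ∈? p)))))
∣∣≡sum-χ (outside ∷ p) = trans (∣∣≡sum-χ p) (sum-cong (λ x → sym (χ-map′ (x ∈? p))))

-- ∑_{t<k} h t, defined so that sumℕ (suc k) h reduces to h 0 + sumℕ k (h ∘ suc).
sumℕ : ℕ → (ℕ → ℕ) → ℕ
sumℕ k h = sum {k} (h ∘ toℕ)

sumℕ-snoc : ∀ k (h : ℕ → ℕ) → sumℕ (suc k) h ≡ sumℕ k h + h k
sumℕ-snoc zero    h = +-comm (h 0) 0
sumℕ-snoc (suc k) h = trans (cong (h 0 +_) (sumℕ-snoc k (h ∘ suc))) (sym (+-assoc (h 0) _ _))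

sumℕ-+ : ∀ a b (h : ℕ → ℕ) → sumℕ (a + b) h ≡ sumℕ a h + sumℕ b (λ t → h (a + t))
sumℕ-+ zero    b h = refl
sumℕ-+ (suc a) b h = trans (cong (h 0 +_) (sumℕ-+ a b (h ∘ suc))) (sym (+-assoc (h 0) _ _))

sumℕ-shift : ∀ k (h : ℕ → ℕ) → h k ≡ h 0 → sumℕ k (h ∘ suc) ≡ sumℕ k h
sumℕ-shift k h hk≡h0 = +-cancelʳ-≡ (h 0) _ _ (begin
  sumℕ k (h ∘ suc) + h 0 ≡⟨ +-comm _ (h 0) ⟩
  sumℕ (suc k) h         ≡⟨ sumℕ-snoc k h ⟩
  sumℕ k h + h k         ≡⟨ cong (sumℕ k h +_) hk≡h0 ⟩
  sumℕ k h + h 0         ∎)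
  where open ≡-Reasoning

sumℕ-rotate : ∀ k (h : ℕ → ℕ) → (∀ t → h (t + k) ≡ h t) → ∀ o → sumℕ k (λ t → h (o + t)) ≡ sumℕ k h
sumℕ-rotate k h periodic zero    = refl
sumℕ-rotate k h periodic (suc o) = begin
  sumℕ k (λ t → h (suc o + t)) ≡⟨ sum-cong {k} (λ t → cong h (sym (+-suc o (toℕ t)))) ⟩
  sumℕ k (λ t → h (o + suc t)) ≡⟨ sumℕ-shift k (λ t → h (o + t)) (trans (periodic o) (cong h (sym (+-identityʳ o)))) ⟩
  sumℕ k (λ t → h (o + t))     ≡⟨ sumℕ-rotate k h periodic o ⟩
  sumℕ k h                     ∎
  where open ≡-Reasoning

NoAdjacentOnes : (ℕ → ℕ) → Set
NoAdjacentOnes h = ∀ t → h t + h (suc t) ≤ 1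

private
  sumℕ-two : ∀ m (h : ℕ → ℕ) → sumℕ (suc (suc m + suc m)) h ≡ h 0 + h 1 + sumℕ (suc (m + m)) (h ∘ suc ∘ suc)
  sumℕ-two m h rewrite +-suc m m = sym (+-assoc (h 0) (h 1) _)

noAdjacentOnes⇒sum≤ : ∀ m h → NoAdjacentOnes h → sumℕ (suc (m + m)) h ≤ suc m
noAdjacentOnes⇒sum≤ zero    h noAdj = subst (_≤ 1) (sym (+-identityʳ (h 0))) (m+n≤o⇒m≤o (h 0) (noAdj 0))
noAdjacentOnes⇒sum≤ (suc m) h noAdj = begin
  sumℕ (suc (suc m + suc m)) h                        ≡⟨ sumℕ-two m h ⟩
  h 0 + h 1 + sumℕ (suc (m + m)) (h ∘ suc ∘ suc)      ≤⟨ +-mono-≤ (noAdj 0) (noAdjacentOnes⇒sum≤ m (h ∘ suc ∘ suc) (noAdj ∘ suc ∘ suc)) ⟩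
  suc (suc m)                                         ∎
  where open ≤-Reasoning

noAdjacentOnes-extremal : ∀ m h → NoAdjacentOnes h → suc m ≤ sumℕ (suc (m + m)) h → ∀ j → j ≤ m → h (j + j) ≡ 1
noAdjacentOnes-extremal zero h noAdj ge zero _ =
  ≤-antisym (m+n≤o⇒m≤o (h 0) (noAdj 0)) (subst (1 ≤_) (+-identityʳ (h 0)) ge)
noAdjacentOnes-extremal (suc m) h noAdj ge = evens
  where
  rest : ℕ
  rest = sumℕ (suc (m + m)) (h ∘ suc ∘ suc)
  total : suc (suc m) ≤ h 0 + h 1 + rest
  total = subst (suc (suc m) ≤_) (sumℕ-two m h) ge
  rest≤ : rest ≤ suc m
  rest≤ = noAdjacentOnes⇒sum≤ m (h ∘ suc ∘ suc) (noAdj ∘ suc ∘ suc)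
  rest≥ : suc m ≤ rest
  rest≥ = +-cancelˡ-≤ 1 _ _ (≤-trans total (+-monoˡ-≤ rest (noAdj 0)))
  later : ∀ j → j ≤ m → h (suc (suc (j + j))) ≡ 1
  later = noAdjacentOnes-extremal m (h ∘ suc ∘ suc) (noAdj ∘ suc ∘ suc) rest≥
  h1≡0 : h 1 ≡ 0
  h1≡0 = n≤0⇒n≡0 (+-cancelʳ-≤ 1 (h 1) 0 (subst (λ z → h 1 + z ≤ 1) (later 0 z≤n) (noAdj 1)))
  h0≡1 : h 0 ≡ 1
  h0≡1 = ≤-antisym (m+n≤o⇒m≤o (h 0) (noAdj 0)) (+-cancelʳ-≤ rest 1 (h 0) (begin
    1 + rest          ≤⟨ +-monoʳ-≤ 1 rest≤ ⟩
    suc (suc m)       ≤⟨ total ⟩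
    h 0 + h 1 + rest  ≡⟨ cong (λ z → h 0 + z + rest) h1≡0 ⟩
    h 0 + 0 + rest    ≡⟨ cong (_+ rest) (+-identityʳ (h 0)) ⟩
    h 0 + rest        ∎))
    where open ≤-Reasoning
  evens : ∀ j → j ≤ suc m → h (j + j) ≡ 1
  evens zero    _           = h0≡1
  evens (suc j) (s≤s j≤m) = trans (cong (h ∘ suc) (+-suc j j)) (later j j≤m)

module Congruence (k : ℕ) where

  n : ℕ
  n = suc k

  -- A record rather than a synonym for x % n ≡ y % n, so that x and y remain inferable.
  infix 4 _≈_
  record _≈_ (x y : ℕ) : Set where
    constructor mk
    field mod-≡ : x % n ≡ y % n
  open _≈_ public

  ≈-refl : ∀ {x} → x ≈ x
  ≈-refl = mk refl

  ≈-sym : ∀ {x y} → x ≈ y → y ≈ x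
  ≈-sym (mk p) = mk (sym p)

  ≈-trans : ∀ {x y z} → x ≈ y → y ≈ z → x ≈ z
  ≈-trans (mk p) (mk q) = mk (trans p q)

  ≡⇒≈ : ∀ {x y} → x ≡ y → x ≈ y
  ≡⇒≈ refl = ≈-refl

  ≈-+ : ∀ {a a′ b b′} → a ≈ a′ → b ≈ b′ → a + b ≈ a′ + b′
  ≈-+ {a} {a′} {b} {b′} (mk p) (mk q) = mk (begin
    (a + b) % n           ≡⟨ %-distribˡ-+ a b n ⟩
    (a % n + b % n) % n   ≡⟨ cong₂ (λ u v → (u + v) % n) p q ⟩
    (a′ % n + b′ % n) % n ≡⟨ %-distribˡ-+ a′ b′ n ⟨
    (a′ + b′) % n         ∎)
    where open ≡-Reasoning

  ≈-* : ∀ c {a a′} → a ≈ a′ → c * a ≈ c * a′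
  ≈-* c {a} {a′} (mk p) = mk (begin
    (c * a) % n              ≡⟨ %-distribˡ-* c a n ⟩
    (c % n * (a % n)) % n    ≡⟨ cong (λ u → (c % n * u) % n) p ⟩
    (c % n * (a′ % n)) % n   ≡⟨ %-distribˡ-* c a′ n ⟨
    (c * a′) % n             ∎)
    where open ≡-Reasoning

  %-≈ : ∀ x → x % n ≈ x
  %-≈ x = mk (m%n%n≡m%n x n)

  ≈-by-multiples : ∀ {x y} a b → x + a * n ≡ y + b * n → x ≈ y
  ≈-by-multiples {x} {y} a b eq = mk (begin
    x % n           ≡⟨ [m+kn]%n≡m%n x a n ⟨
    (x + a * n) % n ≡⟨ cong (_% n) eq ⟩
    (y + b * n) % n ≡⟨ [m+kn]%n≡m%n y b n ⟩
    y % n           ∎)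
    where open ≡-Reasoning

  +-multiple-≈ : ∀ x a → x + a * n ≈ x
  +-multiple-≈ x a = ≈-by-multiples 0 a (+-identityʳ (x + a * n))

  +n-≈ : ∀ x → x + n ≈ x
  +n-≈ x = ≈-by-multiples 0 1 (trans (+-identityʳ (x + n)) (cong (x +_) (sym (*-identityˡ n))))

  ≈-setoid : Setoid 0ℓ 0ℓ
  ≈-setoid = record { _≈_ = _≈_ ; isEquivalence = record { refl = ≈-refl ; sym = ≈-sym ; trans = ≈-trans } }

  module ≈-Reasoning = SetoidReasoning ≈-setoid

  ≈-cancelʳ : ∀ x y z → x + z ≈ y + z → x ≈ y
  ≈-cancelʳ x y z x+z≈y+z = begin
    x             ≈⟨ +-multiple-≈ x z ⟨
    x + z * n     ≡⟨ expand x z k ⟩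
    x + z + k * z ≈⟨ ≈-+ x+z≈y+z (≈-refl {k * z}) ⟩
    y + z + k * z ≡⟨ expand y z k ⟨
    y + z * n     ≈⟨ +-multiple-≈ y z ⟩
    y             ∎
    where
    open ≈-Reasoning
    expand : ∀ w z k → w + z * suc k ≡ w + z + k * z
    expand = solve-∀

  ≈⇒≡ : ∀ {x y} → x < n → y < n → x ≈ y → x ≡ y
  ≈⇒≡ {x} {y} x<n y<n (mk p) = trans (sym (m<n⇒m%n≡m x<n)) (trans p (m<n⇒m%n≡m y<n))

  toℕ-mod : ∀ m → toℕ (m mod n) ≡ m % n
  toℕ-mod m = toℕ-fromℕ< (m%n<n m n)

  mod-cong : ∀ {x y} → x ≈ y → x mod n ≡ y mod n
  mod-cong {x} {y} (mk p) = fromℕ<-cong _ _ p (m%n<n x n) (m%n<n y n)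

  mod-injective : ∀ {x y} → x mod n ≡ y mod n → x ≈ y
  mod-injective {x} {y} eq = mk (trans (sym (toℕ-mod x)) (trans (cong toℕ eq) (toℕ-mod y)))

  toℕ-mod-≈ : ∀ m → toℕ (m mod n) ≈ m
  toℕ-mod-≈ m = ≈-trans (≡⇒≈ (toℕ-mod m)) (%-≈ m)

  mod-toℕ : ∀ (i : Fin n) → toℕ i mod n ≡ i
  mod-toℕ i = trans (fromℕ<-cong _ _ (m<n⇒m%n≡m (toℕ<n i)) (m%n<n (toℕ i) n) (toℕ<n i)) (fromℕ<-toℕ i (toℕ<n i))

  mod-adjacent : ∀ m → Cycle n (m mod n) (suc m mod n)
  mod-adjacent m = inj₁ (begin
    toℕ (suc m mod n)        ≡⟨ toℕ-mod (suc m) ⟩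
    suc m % n                ≡⟨ cong (_% n) (+-comm 1 m) ⟩
    (m + 1) % n              ≡⟨ mod-≡ (≈-+ (≈-sym (%-≈ m)) (≈-refl {1})) ⟩
    (m % n + 1) % n          ≡⟨ cong (λ u → (u + 1) % n) (toℕ-mod m) ⟨
    (toℕ (m mod n) + 1) % n  ∎)
    where open ≡-Reasoning

  successor-offset : ∀ a x y → suc x < n → y < n → toℕ ((a + y) mod n) ≡ (toℕ ((a + x) mod n) + 1) % n → y ≡ suc x
  successor-offset a x y 1+x<n y<n eq = ≈⇒≡ y<n 1+x<n (≈-cancelʳ y (suc x) a (mk (begin
    (y + a) % n                         ≡⟨ cong (_% n) (+-comm y a) ⟩
    (a + y) % n                         ≡⟨ toℕ-mod (a + y) ⟨
    toℕ ((a + y) mod n)                 ≡⟨ m<n⇒m%n≡m (toℕ<n ((a + y) mod n)) ⟨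
    toℕ ((a + y) mod n) % n             ≡⟨ cong (_% n) eq ⟩
    (toℕ ((a + x) mod n) + 1) % n % n   ≡⟨ m%n%n≡m%n (toℕ ((a + x) mod n) + 1) n ⟩
    (toℕ ((a + x) mod n) + 1) % n       ≡⟨ mod-≡ (≈-+ (toℕ-mod-≈ (a + x)) (≈-refl {1})) ⟩
    (a + x + 1) % n                     ≡⟨ cong (_% n) (reorder a x) ⟩
    (suc x + a) % n                     ∎)))
    where
    open ≡-Reasoning
    reorder : ∀ a x → a + x + 1 ≡ suc x + a
    reorder = solve-∀

module OddCycle (s : ℕ) where
  open Congruence (2 * s) public

  2r+1<n : ∀ {r} → r < s → suc (2 * r) < n
  2r+1<n r<s = s≤s (≤-trans (n≤1+n _) (subst (_≤ 2 * s) (*-suc 2 _) (*-monoʳ-≤ 2 r<s)))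

  2r<n : ∀ {r} → r < s → 2 * r < n
  2r<n r<s = <-trans (n<1+n _) (2r+1<n r<s)

  double-half : ∀ u → 2 * (u * suc s) ≈ u
  double-half u = ≈-trans (≡⇒≈ (expand u s)) (+-multiple-≈ u u)
    where
    expand : ∀ u s → 2 * (u * suc s) ≡ u + u * suc (2 * s)
    expand = solve-∀

  progression-nonadjacent : ∀ a {r r′} → r < s → r′ < s → ¬ C s ((a + 2 * r) mod n) ((a + 2 * r′) mod n)
  progression-nonadjacent a {r} {r′} r<s r′<s (inj₁ eq) = even≢odd r′ r (successor-offset a (2 * r) (2 * r′) (2r+1<n r<s) (2r<n r′<s) eq)
  progression-nonadjacent a {r} {r′} r<s r′<s (inj₂ eq) = even≢odd r r′ (successor-offset a (2 * r′) (2 * r) (2r+1<n r′<s) (2r<n r<s) eq)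

-- An independent set contains at most one endpoint of each of the 2s+1 edges, so with s vertices
-- some edge {g, g+1} is missed entirely; cutting the cycle there leaves a path on 2s−1 vertices
-- carrying all s of them, which forces them onto every second vertex.
independent-progression : ∀ s (I : Subset (suc (2 * s))) → Independent (C s) I → ∣ I ∣ ≡ s →
  ∃ λ u → ∀ j → j < s → (u + 2 * j) mod suc (2 * s) ∈ I
independent-progression zero    I _     _    = 0 , λ _ ()
independent-progression (suc m) I indep size = suc (suc g) , λ j j<s →
  subst (λ t → (suc (suc g) + (j + t)) mod n ∈ I) (sym (+-identityʳ j))
    (χ≡1⇒ (member? (suc (suc g) + (j + j))) (noAdjacentOnes-extremal m window windowNoAdj windowSum j (≤-pred j<s)))
  where
  s : ℕ
  s = suc m
  open OddCycle s

  Member : ℕ → Set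
  Member k = k mod n ∈ I

  member? : ∀ k → Dec (Member k)
  member? k = k mod n ∈? I

  ind : ℕ → ℕ
  ind k = χ (member? k)

  ind-periodic : ∀ k → ind (k + n) ≡ ind k
  ind-periodic k = cong (λ v → χ (v ∈? I)) (mod-cong (+n-≈ k))

  ind-sum : sumℕ n ind ≡ s
  ind-sum = begin
    sum {n} (ind ∘ toℕ)           ≡⟨ sum-cong {n} (λ x → cong (λ v → χ (v ∈? I)) (mod-toℕ x)) ⟩
    sum (λ x → χ (x ∈? I))        ≡⟨ ∣∣≡sum-χ I ⟨
    ∣ I ∣                          ≡⟨ size ⟩
    s                              ∎
    where open ≡-Reasoning

  nonadjacent : ∀ k → Member k → ¬ Member (suc k)
  nonadjacent k k∈I 1+k∈I = indep (k mod n) (suc k mod n) k∈I 1+k∈I (mod-adjacent k)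

  edgeCount : ℕ → ℕ
  edgeCount k = ind k + ind (suc k)

  edgeCount≤1 : ∀ k → edgeCount k ≤ 1
  edgeCount≤1 k with member? k | member? (suc k)
  ... | yes k∈I | yes 1+k∈I = ⊥-elim (nonadjacent k k∈I 1+k∈I)
  ... | yes _   | no _      = ≤-refl
  ... | no _    | yes _     = ≤-refl
  ... | no _    | no _      = z≤n

  edgeCount-sum : sumℕ n edgeCount ≡ s + s
  edgeCount-sum = begin
    sumℕ n edgeCount                ≡⟨ ∑-distrib-+ {n} (ind ∘ toℕ) (ind ∘ suc ∘ toℕ) ⟩
    sumℕ n ind + sumℕ n (ind ∘ suc) ≡⟨ cong (sumℕ n ind +_) (sumℕ-shift n ind (ind-periodic 0)) ⟩
    sumℕ n ind + sumℕ n ind         ≡⟨ cong₂ _+_ ind-sum ind-sum ⟩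
    s + s                           ∎
    where open ≡-Reasoning

  gap : ∃ λ g → ind g ≡ 0 × ind (suc g) ≡ 0
  gap with all? (λ (x : Fin n) → 1 ≤? edgeCount (toℕ x))
  ... | yes covered = ⊥-elim (<⇒≱ s+s<n (subst (n ≤_) edgeCount-sum (sum-≥-length {n} covered)))
    where
    s+s<n : s + s < n
    s+s<n = s≤s (≤-reflexive (cong (s +_) (sym (+-identityʳ s))))
  ... | no ¬covered with ¬∀⟶∃¬ n _ (λ x → 1 ≤? edgeCount (toℕ x)) ¬covered
  ...   | x , missed = toℕ x , m+n≡0⇒m≡0 (ind (toℕ x)) empty , m+n≡0⇒n≡0 (ind (toℕ x)) empty
    where
    empty : edgeCount (toℕ x) ≡ 0
    empty = n≤0⇒n≡0 (≤-pred (≰⇒> missed))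

  g : ℕ
  g = proj₁ gap

  window : ℕ → ℕ
  window t = ind (suc (suc g) + t)

  windowNoAdj : NoAdjacentOnes window
  windowNoAdj t = subst (λ v → window t + ind v ≤ 1) (sym (+-suc (suc (suc g)) t)) (edgeCount≤1 (suc (suc g) + t))

  windowSum : suc m ≤ sumℕ (suc (m + m)) window
  windowSum = ≤-reflexive (sym (begin
    sumℕ (suc (m + m)) window                                      ≡⟨ +-identityʳ _ ⟨
    sumℕ (suc (m + m)) window + 0                                  ≡⟨ cong (sumℕ (suc (m + m)) window +_) (sym gapSum) ⟩
    sumℕ (suc (m + m)) window + sumℕ 2 (λ t → window (suc (m + m) + t)) ≡⟨ sumℕ-+ (suc (m + m)) 2 window ⟨
    sumℕ (suc (m + m) + 2) window                                  ≡⟨ cong (λ k → sumℕ k window) (lengths m) ⟩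
    sumℕ n window                                                  ≡⟨ sumℕ-rotate n ind ind-periodic (suc (suc g)) ⟩
    sumℕ n ind                                                     ≡⟨ ind-sum ⟩
    suc m                                                          ∎))
    where
    open ≡-Reasoning
    lengths : ∀ m → suc (m + m) + 2 ≡ suc (2 * suc m)
    lengths = solve-∀
    wraps : ∀ g m t → suc (suc g) + (suc (m + m) + t) ≡ g + t + suc (2 * suc m)
    wraps = solve-∀
    gapAt : ∀ t → window (suc (m + m) + t) ≡ ind (g + t)
    gapAt t = trans (cong ind (wraps g m t)) (ind-periodic (g + t))
    gapSum : sumℕ 2 (λ t → window (suc (m + m) + t)) ≡ 0
    gapSum = cong₂ _+_ (trans (gapAt 0) (trans (cong ind (+-identityʳ g)) (proj₁ (proj₂ gap))))
                       (cong (_+ 0) (trans (gapAt 1) (trans (cong ind (+-comm g 1)) (proj₂ (proj₂ gap)))))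

-- If every value had two preimages, the two choices of preimage would inject Fin (K + K) into Fin N.
module _ {N K} (f : Fin N → Fin K) where
  private
    TwoPreimages : Fin K → Set
    TwoPreimages r = ∃ λ p → ∃ λ q → p ≢ q × f p ≡ r × f q ≡ r

    twoPreimages? : ∀ r → Dec (TwoPreimages r)
    twoPreimages? r = any? λ p → any? λ q → ¬? (p Finₚ.≟ q) ×-dec (f p Finₚ.≟ r) ×-dec (f q Finₚ.≟ r)

    module Doubled (two : ∀ r → TwoPreimages r) where
      choice : Fin K ⊎ Fin K → Fin N
      choice (inj₁ r) = proj₁ (two r)
      choice (inj₂ r) = proj₁ (proj₂ (two r))

      label : Fin K ⊎ Fin K → Fin K
      label = [ (λ r → r) , (λ r → r) ]′

      f∘choice : ∀ a → f (choice a) ≡ label a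
      f∘choice (inj₁ r) = proj₁ (proj₂ (proj₂ (proj₂ (two r))))
      f∘choice (inj₂ r) = proj₂ (proj₂ (proj₂ (proj₂ (two r))))

      choice-injective : ∀ a b → choice a ≡ choice b → a ≡ b
      choice-injective a b eq with trans (sym (f∘choice a)) (trans (cong f eq) (f∘choice b))
      choice-injective (inj₁ r) (inj₁ r) eq | refl = refl
      choice-injective (inj₂ r) (inj₂ r) eq | refl = refl
      choice-injective (inj₁ r) (inj₂ r) eq | refl = ⊥-elim (proj₁ (proj₂ (proj₂ (two r))) eq)
      choice-injective (inj₂ r) (inj₁ r) eq | refl = ⊥-elim (proj₁ (proj₂ (proj₂ (two r))) (sym eq))

      splitAt-injective : ∀ {i j : Fin (K + K)} → splitAt K i ≡ splitAt K j → i ≡ j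
      splitAt-injective {i} {j} eq = trans (sym (join-splitAt K K i)) (trans (cong (join K K) eq) (join-splitAt K K j))

  singleton-fibre : N < K + K → (∀ r → ∃ λ p → f p ≡ r) → ∃ λ c → ∀ c′ → f c′ ≡ f c → c′ ≡ c
  singleton-fibre N<K+K surjective with all? twoPreimages?
  ... | yes two with pigeonhole N<K+K (Doubled.choice two ∘ splitAt K)
  ...   | i , j , i<j , eq = ⊥-elim (<-irrefl (cong toℕ (splitAt-injective (choice-injective _ _ eq))) i<j)
    where open Doubled two
  singleton-fibre N<K+K surjective | no ¬two with ¬∀⟶∃¬ K _ twoPreimages? ¬two
  ... | r , ¬twoAt = c , unique
    where
    c : Fin N
    c = proj₁ (surjective r)
    unique : ∀ c′ → f c′ ≡ f c → c′ ≡ c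
    unique c′ eq with c′ Finₚ.≟ c
    ... | yes c′≡c = c′≡c
    ... | no c′≢c  = ⊥-elim (¬twoAt (c′ , c , c′≢c , trans eq (proj₂ (surjective r)) , proj₂ (surjective r)))

-- For nondecreasing G the quantity G p − p drops by at most one per step, so it cannot jump over a value.
discrete-ivt : (G : ℕ → ℕ) → (∀ p → G p ≤ G (suc p)) → ∀ T τ {x y} → x ≤ y →
  T + x ≤ G x + τ → G y + τ ≤ T + y → ∃ λ p → x ≤ p × p ≤ y × G p + τ ≡ T + p
discrete-ivt G step T τ {x} {y} x≤y lo hi = go (y ∸ x) x (m+[n∸m]≡n x≤y) lo
  where
  go : ∀ k x → x + k ≡ y → T + x ≤ G x + τ → ∃ λ p → x ≤ p × p ≤ y × G p + τ ≡ T + p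
  go zero x x+0≡y lo with trans (sym (+-identityʳ x)) x+0≡y
  ... | refl = x , ≤-refl , ≤-refl , ≤-antisym hi lo
  go (suc k) x x+k≡y lo with G x + τ ≟ T + x
  ... | yes eq = x , ≤-refl , subst (x ≤_) x+k≡y (m≤m+n x (suc k)) , eq
  ... | no neq with go k (suc x) (trans (sym (+-suc x k)) x+k≡y) lo′
    where
    lo′ : T + suc x ≤ G (suc x) + τ
    lo′ = begin
      T + suc x   ≡⟨ +-suc T x ⟩
      suc (T + x) ≤⟨ ≤∧≢⇒< lo (neq ∘ sym) ⟩
      G x + τ     ≤⟨ +-monoˡ-≤ τ (step x) ⟩
      G (suc x) + τ ∎
      where open ≤-Reasoning
  ...   | p , 1+x≤p , p≤y , eq = p , ≤-trans (n≤1+n x) 1+x≤p , p≤y , eq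

module CycleLemma (s : ℕ) (a : Fin s → ℕ) (a<n : ∀ i → a i < suc (2 * s)) where

  n : ℕ
  n = suc (2 * s)

  N : ℕ → ℕ
  N p = sum (λ i → χ (a i <? p)) + sum (λ i → χ (a i + n <? p))

  N-step : ∀ p → N p ≤ N (suc p)
  N-step p = +-mono-≤ (sum-mono-≤ (λ i → χ-mono (a i <? p) _ m<n⇒m<1+n))
                      (sum-mono-≤ (λ i → χ-mono (a i + n <? p) _ m<n⇒m<1+n))

  N-zero : N 0 ≡ 0
  N-zero = cong₂ _+_ (sum-zero (λ i → χ-no (a i <? 0) λ ())) (sum-zero (λ i → χ-no (a i + n <? 0) λ ()))

  N-periodic : ∀ p → p ≤ n → N (p + n) ≡ N p + s
  N-periodic p p≤n = begin
    sum (λ i → χ (a i <? p + n)) + sum (λ i → χ (a i + n <? p + n))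
      ≡⟨ cong₂ _+_ (sum-one {s} (λ i → χ-yes (a i <? p + n) (≤-trans (a<n i) (m≤n+m n p))))
                   (sum-cong (λ i → χ-cong (a i + n <? p + n) (a i <? p) (+-cancelʳ-< n (a i) p) (+-monoˡ-< n))) ⟩
    s + sum (λ i → χ (a i <? p))
      ≡⟨ +-comm s _ ⟩
    sum (λ i → χ (a i <? p)) + s
      ≡⟨ cong (λ z → z + s) (+-identityʳ _) ⟨
    sum (λ i → χ (a i <? p)) + 0 + s
      ≡⟨ cong (λ z → sum (λ i → χ (a i <? p)) + z + s) (sum-zero λ i → χ-no (a i + n <? p) (λ lt → <⇒≱ lt (≤-trans p≤n (m≤n+m n (a i))))) ⟨
    N p + s ∎
    where open ≡-Reasoning

  open Congruence s using (mod-cong; ≈-by-multiples; mod-toℕ)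

  -- The residue of N p − p modulo s + 1, kept inside ℕ by adding (s + 1) p.
  class : ℕ → Fin (suc s)
  class p = (N p + s * p) mod suc s

  class-≡ : ∀ {c p} k → N p + c + k * suc s ≡ N c + p → class p ≡ class c
  class-≡ {c} {p} k eq = mod-cong (≈-by-multiples (c + k) p (begin
    N p + s * p + (c + k) * suc s     ≡⟨ lhs (N p) s p c k ⟩
    N p + c + k * suc s + s * (p + c) ≡⟨ cong (_+ s * (p + c)) eq ⟩
    N c + p + s * (p + c)             ≡⟨ rhs (N c) s p c ⟩
    N c + s * c + p * suc s           ∎))
    where
    open ≡-Reasoning
    lhs : ∀ x s p c k → x + s * p + (c + k) * suc s ≡ x + c + k * suc s + s * (p + c)
    lhs = solve-∀
    rhs : ∀ y s p c → y + p + s * (p + c) ≡ y + s * c + p * suc s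
    rhs = solve-∀

  class-periodic : ∀ p → p ≤ n → class (p + n) ≡ class p
  class-periodic p p≤n = class-≡ 1 (begin
    N (p + n) + p + 1 * suc s ≡⟨ cong (λ z → z + p + 1 * suc s) (N-periodic p p≤n) ⟩
    N p + s + p + 1 * suc s   ≡⟨ shuffle (N p) s p ⟩
    N p + (p + n)             ∎)
    where
    open ≡-Reasoning
    shuffle : ∀ x s p → x + s + p + 1 * suc s ≡ x + (p + suc (2 * s))
    shuffle = solve-∀

  N-n : N n ≡ s
  N-n = trans (N-periodic 0 z≤n) (cong (_+ s) N-zero)

  s+s<n : s + s < n
  s+s<n = s≤s (≤-reflexive (cong (s +_) (sym (+-identityʳ s))))

  level : ∀ k → k ≤ s → ∃ λ p → p < n × N p + k ≡ p
  level k k≤s = pick (discrete-ivt N N-step 0 k z≤n z≤n (≤-trans bound (<⇒≤ s+s<n)))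
    where
    bound : N n + k ≤ s + s
    bound = subst (λ z → z + k ≤ s + s) (sym N-n) (+-monoʳ-≤ s k≤s)
    pick : (∃ λ p → 0 ≤ p × p ≤ n × N p + k ≡ p) → ∃ λ p → p < n × N p + k ≡ p
    pick (p , _ , p≤n , eq) = p , ≤∧≢⇒< p≤n (λ { refl → <⇒≱ s+s<n (subst (_≤ s + s) eq bound) }) , eq

  classF : Fin n → Fin (suc s)
  classF x = class (toℕ x)

  class-level : ∀ {k} t j → k ≤ s → k + t ≡ j * suc s → ∃ λ x → classF x ≡ t mod suc s
  class-level {k} t j k≤s k+t≡ = fromℕ< p<n , (begin
    class (toℕ (fromℕ< p<n)) ≡⟨ cong class (toℕ-fromℕ< p<n) ⟩
    class p                  ≡⟨ mod-cong (≈-by-multiples j p witness) ⟩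
    t mod suc s              ∎)
    where
    open ≡-Reasoning
    p : ℕ
    p = proj₁ (level k k≤s)
    p<n : p < n
    p<n = proj₁ (proj₂ (level k k≤s))
    witness : N p + s * p + j * suc s ≡ t + p * suc s
    witness = begin
      N p + s * p + j * suc s ≡⟨ cong (N p + s * p +_) (sym k+t≡) ⟩
      N p + s * p + (k + t)   ≡⟨ shuffle (N p) s p k t ⟩
      N p + k + s * p + t     ≡⟨ cong (λ z → z + s * p + t) (proj₂ (proj₂ (level k k≤s))) ⟩
      p + s * p + t           ≡⟨ collect p s t ⟩
      t + p * suc s           ∎
      where
      shuffle : ∀ x s p k t → x + s * p + (k + t) ≡ x + k + s * p + t
      shuffle = solve-∀
      collect : ∀ p s t → p + s * p + t ≡ t + p * suc s
      collect = solve-∀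

  -- A point of level s ∸ t has class t + 1; level 0 gives class 0.
  classF-surjective : ∀ r → ∃ λ x → classF x ≡ r
  classF-surjective r = subst (λ z → ∃ λ x → classF x ≡ z) (mod-toℕ r) (hits (toℕ r) (≤-pred (toℕ<n r)))
    where
    hits : ∀ t → t ≤ s → ∃ λ x → classF x ≡ t mod suc s
    hits zero    _     = class-level 0 0 z≤n refl
    hits (suc t) 1+t≤s = class-level (suc t) 1 (m∸n≤m s t)
      (trans (+-suc (s ∸ t) t) (trans (cong suc (m∸n+n≡m (<⇒≤ 1+t≤s))) (sym (*-identityˡ (suc s)))))

  record GoodCut (c : ℕ) : Set where
    field
      c<n    : c < n
      sparse : ∀ L → 1 ≤ L → L < n → N (c + L) < N c + L
      dense  : ∀ L → 1 ≤ L → L < n → N c + s + L < N (c + L) + n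

  s<n : s < n
  s<n = ≤-<-trans (m≤m+n s s) s+s<n

  -- A point alone in its class is a good cut: a violation would, by the discrete intermediate value
  -- theorem, produce another point of the same class within one period.
  module AloneInClass (c : Fin n) (alone : ∀ c′ → classF c′ ≡ classF c → c′ ≡ c) where
    private
      c′ : ℕ
      c′ = toℕ c

    no-other : ∀ p → c′ < p → p < c′ + n → class p ≡ class c′ → ⊥
    no-other p c<p p<c+n same with p <? n
    ... | yes p<n = <⇒≢ c<p (sym (trans (sym (toℕ-fromℕ< p<n)) (cong toℕ (alone (fromℕ< p<n) (trans (cong class (toℕ-fromℕ< p<n)) same)))))
    ... | no p≮n = <⇒≢ q<c (trans (sym (toℕ-fromℕ< q<n)) (cong toℕ (alone (fromℕ< q<n) (trans (cong class (toℕ-fromℕ< q<n)) classq))))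
      where
      q : ℕ
      q = p ∸ n
      q+n≡p : q + n ≡ p
      q+n≡p = m∸n+n≡m (≮⇒≥ p≮n)
      q<c : q < c′
      q<c = +-cancelʳ-< n q c′ (subst (_< c′ + n) (sym q+n≡p) p<c+n)
      q<n : q < n
      q<n = <-trans q<c (toℕ<n c)
      classq : class q ≡ class c′
      classq = trans (sym (class-periodic q (<⇒≤ q<n))) (trans (cong class q+n≡p) same)

    N-c+n : N (c′ + n) ≡ N c′ + s
    N-c+n = N-periodic c′ (<⇒≤ (toℕ<n c))

    sparse : ∀ L → 1 ≤ L → L < n → N (c′ + L) < N c′ + L
    sparse L 1≤L L<n = ≰⇒> violation
      where
      violation : N c′ + L ≤ N (c′ + L) → ⊥
      violation full with discrete-ivt N N-step (N c′) c′ (+-monoʳ-≤ c′ (<⇒≤ L<n)) lo hi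
        where
        lo : N c′ + (c′ + L) ≤ N (c′ + L) + c′
        lo = begin
          N c′ + (c′ + L) ≡⟨ cong (N c′ +_) (+-comm c′ L) ⟩
          N c′ + (L + c′) ≡⟨ +-assoc (N c′) L c′ ⟨
          N c′ + L + c′   ≤⟨ +-monoˡ-≤ c′ full ⟩
          N (c′ + L) + c′ ∎
          where open ≤-Reasoning
        hi : N (c′ + n) + c′ ≤ N c′ + (c′ + n)
        hi = begin
          N (c′ + n) + c′ ≡⟨ cong (_+ c′) N-c+n ⟩
          N c′ + s + c′   ≡⟨ xy∙z≈xz∙y (N c′) s c′ ⟩
          N c′ + c′ + s   ≤⟨ +-monoʳ-≤ (N c′ + c′) (<⇒≤ s<n) ⟩
          N c′ + c′ + n   ≡⟨ +-assoc (N c′) c′ n ⟩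
          N c′ + (c′ + n) ∎
          where open ≤-Reasoning
      ... | p , c+L≤p , p≤c+n , eq =
        no-other p (<-≤-trans (m<m+n c′ 1≤L) c+L≤p) (≤∧≢⇒< p≤c+n p≢c+n) (class-≡ 0 (trans (+-identityʳ _) eq))
        where
        p≢c+n : p ≢ c′ + n
        p≢c+n refl = <⇒≢ s<n (+-cancelˡ-≡ (N c′ + c′) s n (begin
          N c′ + c′ + s      ≡⟨ xy∙z≈xz∙y (N c′) c′ s ⟩
          N c′ + s + c′      ≡⟨ cong (_+ c′) N-c+n ⟨
          N (c′ + n) + c′    ≡⟨ eq ⟩
          N c′ + (c′ + n)    ≡⟨ +-assoc (N c′) c′ n ⟨
          N c′ + c′ + n      ∎))
          where open ≡-Reasoning

    dense : ∀ L → 1 ≤ L → L < n → N c′ + s + L < N (c′ + L) + n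
    dense L 1≤L L<n = ≰⇒> violation
      where
      violation : N (c′ + L) + n ≤ N c′ + s + L → ⊥
      violation thin with discrete-ivt N N-step (N c′ + s) (c′ + n) (m≤m+n c′ L) lo hi
        where
        lo : N c′ + s + c′ ≤ N c′ + (c′ + n)
        lo = begin
          N c′ + s + c′   ≡⟨ xy∙z≈xz∙y (N c′) s c′ ⟩
          N c′ + c′ + s   ≤⟨ +-monoʳ-≤ (N c′ + c′) (<⇒≤ s<n) ⟩
          N c′ + c′ + n   ≡⟨ +-assoc (N c′) c′ n ⟩
          N c′ + (c′ + n) ∎
          where open ≤-Reasoning
        hi : N (c′ + L) + (c′ + n) ≤ N c′ + s + (c′ + L)
        hi = begin
          N (c′ + L) + (c′ + n) ≡⟨ cong (N (c′ + L) +_) (+-comm c′ n) ⟩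
          N (c′ + L) + (n + c′) ≡⟨ +-assoc (N (c′ + L)) n c′ ⟨
          N (c′ + L) + n + c′   ≤⟨ +-monoˡ-≤ c′ thin ⟩
          N c′ + s + L + c′     ≡⟨ +-assoc (N c′ + s) L c′ ⟩
          N c′ + s + (L + c′)   ≡⟨ cong (N c′ + s +_) (+-comm L c′) ⟩
          N c′ + s + (c′ + L)   ∎
          where open ≤-Reasoning
      ... | p , c≤p , p≤c+L , eq =
        no-other p (≤∧≢⇒< c≤p c≢p) (≤-<-trans p≤c+L (+-monoʳ-< c′ L<n)) (class-≡ 1 lapped)
        where
        c≢p : c′ ≢ p
        c≢p refl = <⇒≢ s<n (sym (+-cancelˡ-≡ (N c′ + c′) n s (begin
          N c′ + c′ + n      ≡⟨ +-assoc (N c′) c′ n ⟩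
          N c′ + (c′ + n)    ≡⟨ eq ⟩
          N c′ + s + c′      ≡⟨ xy∙z≈xz∙y (N c′) s c′ ⟩
          N c′ + c′ + s      ∎)))
          where open ≡-Reasoning
        lapped : N p + c′ + 1 * suc s ≡ N c′ + p
        lapped = +-cancelʳ-≡ s _ _ (begin
          N p + c′ + 1 * suc s + s ≡⟨ unfold (N p) c′ s ⟩
          N p + (c′ + n)           ≡⟨ eq ⟩
          N c′ + s + p             ≡⟨ xy∙z≈xz∙y (N c′) s p ⟩
          N c′ + p + s             ∎)
          where
          open ≡-Reasoning
          unfold : ∀ x c s → x + c + 1 * suc s + s ≡ x + (c + suc (2 * s))
          unfold = solve-∀

  good-cut : ∃ GoodCut
  good-cut with singleton-fibre classF n<2[1+s] classF-surjective
    where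
    n<2[1+s] : n < suc s + suc s
    n<2[1+s] = ≤-reflexive (lengths s)
      where
      lengths : ∀ s → suc (suc (2 * s)) ≡ suc s + suc s
      lengths = solve-∀
  ... | c , alone = toℕ c , record { c<n = toℕ<n c ; sparse = sparse ; dense = dense }
    where open AloneInClass c alone

module Ranking (s : ℕ) (a : Fin s → ℕ) (a<n : ∀ i → a i < suc (2 * s)) (c : ℕ)
               (good : CycleLemma.GoodCut s a a<n c) where
  open CycleLemma s a a<n using (n; N; s<n)
  open CycleLemma.GoodCut good

  offset : Fin s → ℕ
  offset i with c ≤? a i
  ... | yes _ = a i ∸ c
  ... | no _  = a i + n ∸ c

  offset-cases : ∀ i → (c ≤ a i × offset i + c ≡ a i) ⊎ (a i < c × offset i + c ≡ a i + n)
  offset-cases i with c ≤? a i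
  ... | yes c≤a = inj₁ (c≤a , m∸n+n≡m c≤a)
  ... | no c≰a  = inj₂ (≰⇒> c≰a , m∸n+n≡m (≤-trans (<⇒≤ c<n) (m≤n+m n (a i))))

  offset<n : ∀ i → offset i < n
  offset<n i with offset-cases i
  ... | inj₁ (_ , eq)   = +-cancelʳ-< c (offset i) n (subst (_< n + c) (sym eq) (<-≤-trans (a<n i) (m≤m+n n c)))
  ... | inj₂ (a<c , eq) = +-cancelʳ-< c (offset i) n (subst₂ _<_ (sym eq) (+-comm c n) (+-monoˡ-< n a<c))

  countBelow : ℕ → ℕ
  countBelow K = sum (λ j → χ (offset j <? K))

  countBelow-N : ∀ K → K ≤ n → countBelow K + N c ≡ N (c + K)
  countBelow-N K K≤n = begin
    countBelow K + (sum (λ j → χ (a j <? c)) + sum (λ j → χ (a j + n <? c)))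
      ≡⟨ cong (λ z → countBelow K + (sum (λ j → χ (a j <? c)) + z)) noneWrapped ⟩
    countBelow K + (sum (λ j → χ (a j <? c)) + 0)
      ≡⟨ cong (countBelow K +_) (+-identityʳ _) ⟩
    countBelow K + sum (λ j → χ (a j <? c))
      ≡⟨ ∑-distrib-+ (λ j → χ (offset j <? K)) (λ j → χ (a j <? c)) ⟨
    sum (λ j → χ (offset j <? K) + χ (a j <? c))
      ≡⟨ sum-cong pointwise ⟩
    sum (λ j → χ (a j <? c + K) + χ (a j + n <? c + K))
      ≡⟨ ∑-distrib-+ (λ j → χ (a j <? c + K)) (λ j → χ (a j + n <? c + K)) ⟩
    N (c + K) ∎
    where
    open ≡-Reasoning
    noneWrapped : sum (λ j → χ (a j + n <? c)) ≡ 0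
    noneWrapped = sum-zero λ j → χ-no (a j + n <? c) (λ lt → <⇒≱ lt (≤-trans (<⇒≤ c<n) (m≤n+m n (a j))))
    pointwise : ∀ j → χ (offset j <? K) + χ (a j <? c) ≡ χ (a j <? c + K) + χ (a j + n <? c + K)
    pointwise j with offset-cases j
    ... | inj₁ (c≤a , eq) = cong₂ _+_
          (χ-cong (offset j <? K) (a j <? c + K)
             (λ lt → subst₂ _<_ eq (+-comm K c) (+-monoˡ-< c lt))
             (λ lt → +-cancelʳ-< c (offset j) K (subst₂ _<_ (sym eq) (+-comm c K) lt)))
          (trans (χ-no (a j <? c) (≤⇒≯ c≤a))
                 (sym (χ-no (a j + n <? c + K) (λ lt → <⇒≱ lt (+-mono-≤ c≤a K≤n)))))
    ... | inj₂ (a<c , eq) = begin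
          χ (offset j <? K) + χ (a j <? c)   ≡⟨ cong (χ (offset j <? K) +_) (χ-yes (a j <? c) a<c) ⟩
          χ (offset j <? K) + 1              ≡⟨ +-comm _ 1 ⟩
          1 + χ (offset j <? K)              ≡⟨ cong₂ _+_ (χ-yes (a j <? c + K) (≤-trans a<c (m≤m+n c K))) wrapped ⟨
          χ (a j <? c + K) + χ (a j + n <? c + K) ∎
      where
      wrapped : χ (a j + n <? c + K) ≡ χ (offset j <? K)
      wrapped = χ-cong (a j + n <? c + K) (offset j <? K)
        (λ lt → +-cancelʳ-< c (offset j) K (subst₂ _<_ (sym eq) (+-comm c K) lt))
        (λ lt → subst₂ _<_ eq (+-comm K c) (+-monoˡ-< c lt))

  _≺_ : Fin s → Fin s → Set
  j ≺ i = offset j < offset i ⊎ (offset j ≡ offset i × toℕ j < toℕ i)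

  _≺?_ : ∀ j i → Dec (j ≺ i)
  j ≺? i = (offset j <? offset i) ⊎-dec ((offset j ≟ offset i) ×-dec (toℕ j <? toℕ i))

  ≺-irrefl : ∀ i → ¬ i ≺ i
  ≺-irrefl i (inj₁ lt)       = <-irrefl refl lt
  ≺-irrefl i (inj₂ (_ , lt)) = <-irrefl refl lt

  ≺-trans : ∀ {k j i} → k ≺ j → j ≺ i → k ≺ i
  ≺-trans (inj₁ p)       (inj₁ q)        = inj₁ (<-trans p q)
  ≺-trans (inj₁ p)       (inj₂ (e , _))  = inj₁ (subst (_ <_) e p)
  ≺-trans (inj₂ (e , _)) (inj₁ q)        = inj₁ (subst (_< _) (sym e) q)
  ≺-trans (inj₂ (e , p)) (inj₂ (e′ , q)) = inj₂ (trans e e′ , <-trans p q)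

  ≺-connex : ∀ i j → i ≢ j → i ≺ j ⊎ j ≺ i
  ≺-connex i j i≢j with <-cmp (offset i) (offset j)
  ... | tri< lt _ _ = inj₁ (inj₁ lt)
  ... | tri> _ _ gt = inj₂ (inj₁ gt)
  ... | tri≈ _ e _ with <-cmp (toℕ i) (toℕ j)
  ...   | tri< lt _ _ = inj₁ (inj₂ (e , lt))
  ...   | tri> _ _ gt = inj₂ (inj₂ (sym e , gt))
  ...   | tri≈ _ e′ _ = ⊥-elim (i≢j (toℕ-injective e′))

  rank : Fin s → ℕ
  rank i = sum (λ j → χ (j ≺? i))

  rank<s : ∀ i → rank i < s
  rank<s i = sum-<-length (λ j → χ≤1 (j ≺? i)) i (χ-no (i ≺? i) (≺-irrefl i))

  rank-mono : ∀ {i j} → i ≺ j → rank i < rank j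
  rank-mono {i} {j} i≺j = sum-mono-< (λ k → χ-mono (k ≺? i) (k ≺? j) (λ k≺i → ≺-trans k≺i i≺j)) i
    (subst₂ _<_ (sym (χ-no (i ≺? i) (≺-irrefl i))) (sym (χ-yes (i ≺? j) i≺j)) (s≤s z≤n))

  rank-injective : ∀ i j → i ≢ j → rank i ≢ rank j
  rank-injective i j i≢j eq with ≺-connex i j i≢j
  ... | inj₁ i≺j = <-irrefl eq (rank-mono i≺j)
  ... | inj₂ j≺i = <-irrefl (sym eq) (rank-mono j≺i)

  -- sparse: fewer than offset i + 1 points have offset ≤ offset i, and i is one of them.
  rank<offset : ∀ i → rank i < offset i
  rank<offset i with offset i <? s
  ... | no  ¬o<s = <-≤-trans (rank<s i) (≮⇒≥ ¬o<s)
  ... | yes o<s  = <-≤-trans rank<count count≤offset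
    where
    L : ℕ
    L = suc (offset i)
    rank<count : rank i < countBelow L
    rank<count = sum-mono-< (λ k → χ-mono (k ≺? i) (offset k <? L) ≺⇒<) i
      (subst₂ _<_ (sym (χ-no (i ≺? i) (≺-irrefl i))) (sym (χ-yes (offset i <? L) ≤-refl)) (s≤s z≤n))
      where
      ≺⇒< : ∀ {k} → k ≺ i → offset k < L
      ≺⇒< (inj₁ lt)      = <-trans lt ≤-refl
      ≺⇒< (inj₂ (e , _)) = s≤s (≤-reflexive e)
    L<n : L < n
    L<n = ≤-<-trans o<s s<n
    count≤offset : countBelow L ≤ offset i
    count≤offset = ≤-pred (+-cancelʳ-≤ (N c) (suc (countBelow L)) L (begin
      suc (countBelow L) + N c  ≡⟨ cong suc (countBelow-N L (<⇒≤ L<n)) ⟩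
      suc (N (c + L))           ≤⟨ sparse L (s≤s z≤n) L<n ⟩
      N c + L                   ≡⟨ +-comm (N c) L ⟩
      L + N c                   ∎))
      where open ≤-Reasoning

  -- dense: at least offset i − s points have offset < offset i, and all of them precede i.
  offset≤rank+s : ∀ i → offset i ≤ rank i + s
  offset≤rank+s i with offset i <? s
  ... | yes o<s  = ≤-trans (<⇒≤ o<s) (m≤n+m s (rank i))
  ... | no  ¬o<s = ≤-trans offset≤count+s (+-monoˡ-≤ s count≤rank)
    where
    K : ℕ
    K = offset i
    count≤rank : countBelow K ≤ rank i
    count≤rank = sum-mono-≤ (λ k → χ-mono (offset k <? K) (k ≺? i) inj₁)
    1≤K : 1 ≤ K
    1≤K = ≤-trans (s≤s z≤n) (≤-trans (toℕ<n i) (≮⇒≥ ¬o<s))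
    offset≤count+s : K ≤ countBelow K + s
    offset≤count+s = +-cancelˡ-≤ (N c + s) K (countBelow K + s) (≤-pred (begin
      suc (N c + s + K)            ≤⟨ dense K 1≤K (offset<n i) ⟩
      N (c + K) + n                ≡⟨ cong (_+ n) (countBelow-N K (<⇒≤ (offset<n i))) ⟨
      countBelow K + N c + n       ≡⟨ rearrange (countBelow K) (N c) s ⟩
      suc (N c + s + (countBelow K + s)) ∎))
      where
      open ≤-Reasoning
      rearrange : ∀ x y s → x + y + suc (2 * s) ≡ suc (y + s + (x + s))
      rearrange = solve-∀

IndependentTransversal : ∀ s → (Fin s → Subset (suc (2 * s))) → Set
IndependentTransversal s I = Σ (Fin s → Fin (suc (2 * s))) λ x →
  (∀ i → x i ∈ I i) × (∀ i j → i ≢ j → x i ≢ x j) × (∀ i j → ¬ C s (x i) (x j))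

independent-transversal : ∀ s (I : Fin s → Subset (suc (2 * s))) →
  (∀ i → IndependentOfSize (C s) s (I i)) → IndependentTransversal s I
independent-transversal s I independent = transversal (CycleLemma.good-cut s a a<n)
  where
  open OddCycle s

  progression : ∀ i → ∃ λ u → ∀ j → j < s → (u + 2 * j) mod n ∈ I i
  progression i = independent-progression s (I i) (proj₁ (independent i)) (proj₂ (independent i))

  u : Fin s → ℕ
  u i = proj₁ (progression i)

  a : Fin s → ℕ
  a i = u i * suc s % n

  a<n : ∀ i → a i < n
  a<n i = m%n<n (u i * suc s) n

  -- The cut is taken as an argument so that the search producing it is never unfolded.
  transversal : ∃ (CycleLemma.GoodCut s a a<n) → IndependentTransversal s I
  transversal (c , good) = x , x∈I , x-injective , x-independent
    where
    open Ranking s a a<n c good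

    base : ℕ
    base = 2 * (c + s)

    x : Fin s → Fin n
    x i = (base + 2 * rank i) mod n

    step : ∀ i → ℕ
    step i = rank i + s ∸ offset i

    step<s : ∀ i → step i < s
    step<s i = +-cancelʳ-< (offset i) (step i) s
      (subst₂ _<_ (sym (m∸n+n≡m (offset≤rank+s i))) (+-comm (offset i) s) (+-monoˡ-< s (rank<offset i)))

    x≈ : ∀ i → base + 2 * rank i ≈ u i + 2 * step i
    x≈ i = ≈-cancelʳ (base + 2 * rank i) (u i + 2 * step i) (2 * offset i) (begin
      base + 2 * rank i + 2 * offset i    ≡⟨ regroup c s (rank i) (offset i) ⟩
      2 * (offset i + c) + 2 * (rank i + s) ≈⟨ ≈-+ (≈-* 2 (≈-trans offset+c≈a (%-≈ (u i * suc s)))) (≈-refl {2 * (rank i + s)}) ⟩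
      2 * (u i * suc s) + 2 * (rank i + s)  ≈⟨ ≈-+ (double-half (u i)) (≈-refl {2 * (rank i + s)}) ⟩
      u i + 2 * (rank i + s)                ≡⟨ cong (λ z → u i + 2 * z) (m∸n+n≡m (offset≤rank+s i)) ⟨
      u i + 2 * (step i + offset i)         ≡⟨ expand (u i) (step i) (offset i) ⟩
      u i + 2 * step i + 2 * offset i       ∎)
      where
      open ≈-Reasoning
      regroup : ∀ c s r y → 2 * (c + s) + 2 * r + 2 * y ≡ 2 * (y + c) + 2 * (r + s)
      regroup = solve-∀
      expand : ∀ u j y → u + 2 * (j + y) ≡ u + 2 * j + 2 * y
      expand = solve-∀
      offset+c≈a : offset i + c ≈ a i
      offset+c≈a with offset-cases i
      ... | inj₁ (_ , eq) = ≡⇒≈ eq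
      ... | inj₂ (_ , eq) = ≈-trans (≡⇒≈ eq) (+n-≈ (a i))

    x∈I : ∀ i → x i ∈ I i
    x∈I i = subst (_∈ I i) (mod-cong (≈-sym (x≈ i))) (proj₂ (progression i) (step i) (step<s i))

    x-injective : ∀ i j → i ≢ j → x i ≢ x j
    x-injective i j i≢j eq = rank-injective i j i≢j (*-cancelˡ-≡ (rank i) (rank j) 2
      (≈⇒≡ (2r<n (rank<s i)) (2r<n (rank<s j))
        (≈-cancelʳ (2 * rank i) (2 * rank j) base
          (≈-trans (≡⇒≈ (+-comm (2 * rank i) base)) (≈-trans (mod-injective eq) (≡⇒≈ (+-comm base (2 * rank j))))))))

    x-independent : ∀ i j → ¬ C s (x i) (x j)
    x-independent i j = progression-nonadjacent base (rank<s i) (rank<s j)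

evenBelow : ℕ → ℕ → Bool
evenBelow zero    _             = false
evenBelow (suc k) zero          = true
evenBelow (suc k) (suc zero)    = false
evenBelow (suc k) (suc (suc t)) = evenBelow k t

evenBelow⇒ : ∀ k t → evenBelow k t ≡ true → ∃ λ j → j < k × t ≡ 2 * j
evenBelow⇒ (suc k) zero          _  = 0 , s≤s z≤n , refl
evenBelow⇒ (suc k) (suc (suc t)) eq with evenBelow⇒ k t eq
... | j , j<k , refl = suc j , s≤s j<k , cong suc (sym (+-suc j (j + 0)))

evens : ∀ s → Subset (suc (2 * s))
evens s = tabulate (evenBelow s ∘ toℕ)

evens-size : ∀ s → ∣ evens s ∣ ≡ s
evens-size s = size s 0
  where
  size : ∀ k r → ∣ tabulate {n = suc (k + (k + r))} (evenBelow k ∘ toℕ) ∣ ≡ k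
  size zero    zero    = refl
  size zero    (suc r) = size zero r
  size (suc k) r rewrite +-suc k (k + r) = cong suc (size k r)

evens-independent : ∀ s → Independent (C s) (evens s)
evens-independent s v w v∈E w∈E adjacent with even v v∈E | even w w∈E
  where
  open OddCycle s
  even : ∀ v → v ∈ evens s → ∃ λ j → j < s × v ≡ (0 + 2 * j) mod n
  even v v∈E with evenBelow⇒ s (toℕ v) (trans (sym (lookup∘tabulate (evenBelow s ∘ toℕ) v)) ([]=⇒lookup v∈E))
  ... | j , j<s , v≡2j = j , j<s , trans (sym (mod-toℕ v)) (cong (_mod n) v≡2j)
... | j , j<s , refl | j′ , j′<s , refl = OddCycle.progression-nonadjacent s 0 j<s j′<s adjacent

theorem1 : (s : ℕ) → 1 ≤ s →
    ((I : Fin s → Subset (suc (2 * s))) → (∀ i → IndependentOfSize (C s) s (I i)) →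
      Σ (Fin s → Fin (suc (2 * s))) λ x →
        (∀ i → x i ∈ I i) × (∀ i j → i ≢ j → x i ≢ x j) × (∀ i j → ¬ C s (x i) (x j)))
    × fIs (C s) s s s
theorem1 s _ = independent-transversal s , good , minimal
  where
  good : Good (C s) s s s
  good I independent = (λ i → i) , proj₁ transversal , (λ _ _ i<j → i<j) , proj₂ transversal
    where
    transversal : IndependentTransversal s I
    transversal = independent-transversal s I independent

  -- A rainbow s-set for k < s copies of one independent s-set would need s distinct indices below k.
  minimal : ∀ k → k < s → ¬ Good (C s) s s k
  minimal k k<s goodₖ with goodₖ (λ _ → evens s) (λ _ → evens-independent s , evens-size s)
  ... | ι , _ , ι-increasing , _ with pigeonhole k<s ι
  ...   | i , j , i<j , ιi≡ιj = <-irrefl (cong toℕ ιi≡ιj) (ι-increasing i j i<j)
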